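{- Let $H$ be a connected bipartite graph, let $(A,B,\phi)$ be a nice triple and let $R$ be admissible for $(A,B,\phi)$. Then for every graph $G$, $$\hom(H,G;R)^2\leq \hom(H,G;\psi_{A,B,\phi}(R))\,\hom(H,G;\psi_{B,A,\phi}(R)).$$ In particular, for every graph $G$, $\hom(H,G;R)^2\leq \hom(H,G;\psi_{A,B,\phi}(R))\,\hom(H,G)$.
   Context: A homomorphism $H\to G$ is a map $V(H)\to V(G)$ sending edges to edges; $\hom(H,G)$ is their number and, for $R\subset V(H)$, $\hom(H,G;R)$ is the number of homomorphisms mapping all vertices of $R$ to the same vertex of $G$. For an automorphism $\phi$ of $H$ let $F_\phi=\{v\in V(H):\phi(v)=v\}$. A triple $(A,B,\phi)$ with $A,B\subset V(H)$ and $\phi$ an automorphism of $H$ is nice if $\phi=\phi^{ -1}$; $A$, $B$, $F_\phi$ partition $V(H)$; $F_\phi$ separates $A$ from $B$ (no edge of $H$ joins $A$ and $B$); and $\phi(A)=B$. A set $R\subset V(H)$ is admissible for $(A,B,\phi)$ if all vertices of $R$ lie in the same part of the bipartition of $H$ and $R$ intersects both $A\cup F_\phi$ and $B\cup F_\phi$. For sets $A,B$ and automorphism $\phi$ define $\psi_{A,B,\phi}(R)=(R\cap(A\cup F_\phi))\cup\phi(R\cap A)$; thus $\psi_{B,A,\phi}(R)=(R\cap(B\cup F_\phi))\cup\phi(R\cap B)$. -}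

module Defs where

open import Data.Nat using (ℕ; zero; suc; _+_)
open import Data.Bool using (Bool; true; false; _∧_; _∨_; not; if_then_else_)
open import Data.Fin using (Fin)
open import Data.Fin.Properties using () renaming (_≟_ to _≟F_)
open import Data.Fin.Subset using (Subset; _∈_)
open import Data.Vec using (Vec; []; _∷_; lookup; tabulate)
open import Data.List using (List; []; _∷_; map; concatMap; allFin)
open import Data.Nat.ListAction using (sum)
open import Data.Bool.ListAction using (all)
open import Data.Product using (Σ; _×_; _,_)
open import Data.Sum using (_⊎_)
open import Data.Empty using (⊥)
open import Relation.Nullary using (¬_)
open import Relation.Nullary.Decidable using (⌊_⌋)
open import Relation.Binary.PropositionalEquality using (_≡_)

record Graph (n : ℕ) : Set where
  field
    adj     : Fin n → Fin n → Bool
    sym     : ∀ u v → adj u v ≡ adj v u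
    loopless : ∀ v → adj v v ≡ false
open Graph public

allVecs : (k m : ℕ) → List (Vec (Fin m) k)
allVecs zero    m = [] ∷ []
allVecs (suc k) m = concatMap (λ xs → map (λ x → x ∷ xs) (allFin m)) (allVecs k m)

isHom : ∀ {h g} → Graph h → Graph g → (Fin h → Fin g) → Bool
isHom {h} H G f =
  all (λ u → all (λ v → not (adj H u v) ∨ adj G (f u) (f v)) (allFin h)) (allFin h)

collapses : ∀ {h g} → Subset h → (Fin h → Fin g) → Bool
collapses {h} R f =
  all (λ u → all (λ v → not (lookup R u ∧ lookup R v) ∨ ⌊ f u ≟F f v ⌋) (allFin h)) (allFin h)

homR : ∀ {h g} → Graph h → Graph g → Subset h → ℕ
homR {h} {g} H G R =
  sum (map (λ xs → if isHom H G (lookup xs) ∧ collapses R (lookup xs) then 1 else 0)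
           (allVecs h g))

hom : ∀ {h g} → Graph h → Graph g → ℕ
hom {h} {g} H G =
  sum (map (λ xs → if isHom H G (lookup xs) then 1 else 0) (allVecs h g))

data Walk {n} (H : Graph n) : Fin n → Fin n → Set where
  []  : ∀ {u} → Walk H u u
  _∷_ : ∀ {u v w} → adj H u v ≡ true → Walk H v w → Walk H u w

Connected : ∀ {n} → Graph n → Set
Connected H = ∀ u v → Walk H u v

ProperTwoColouring : ∀ {n} → Graph n → (Fin n → Bool) → Set
ProperTwoColouring H c = ∀ u v → adj H u v ≡ true → ¬ (c u ≡ c v)

record Automorphism {n} (H : Graph n) : Set where
  field
    to       : Fin n → Fin n
    from     : Fin n → Fin n
    to-from  : ∀ v → to (from v) ≡ v
    from-to  : ∀ v → from (to v) ≡ v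
    preserves : ∀ u v → adj H u v ≡ adj H (to u) (to v)
open Automorphism public

Fixed : ∀ {n} {H : Graph n} → Automorphism H → Fin n → Set
Fixed φ v = to φ v ≡ v

isFixed : ∀ {n} {H : Graph n} → Automorphism H → Fin n → Bool
isFixed φ v = ⌊ to φ v ≟F v ⌋

record Nice {n} (H : Graph n) (A B : Subset n) (φ : Automorphism H) : Set where
  field
    involution : ∀ v → to φ v ≡ from φ v
    cover      : ∀ v → v ∈ A ⊎ v ∈ B ⊎ Fixed φ v
    disjAB     : ∀ v → v ∈ A → v ∈ B → ⊥
    disjAF     : ∀ v → v ∈ A → Fixed φ v → ⊥
    disjBF     : ∀ v → v ∈ B → Fixed φ v → ⊥
    separates  : ∀ u v → u ∈ A → v ∈ B → ¬ (adj H u v ≡ true)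
    imageA⊆B   : ∀ a → a ∈ A → to φ a ∈ B
    B⊆imageA   : ∀ b → b ∈ B → Σ (Fin n) (λ a → a ∈ A × to φ a ≡ b)

record Admissible {n} (H : Graph n) (c : Fin n → Bool) (A B : Subset n)
                  (φ : Automorphism H) (R : Subset n) : Set where
  field
    samePart : ∀ u v → u ∈ R → v ∈ R → c u ≡ c v
    meetsAF  : Σ (Fin n) (λ v → v ∈ R × (v ∈ A ⊎ Fixed φ v))
    meetsBF  : Σ (Fin n) (λ v → v ∈ R × (v ∈ B ⊎ Fixed φ v))

-- ψ_{A,B,φ}(R) = (R ∩ (A ∪ F_φ)) ∪ φ(R ∩ A);  w ∈ φ(S) iff φ⁻¹(w) ∈ S
ψ : ∀ {n} {H : Graph n} → Subset n → Subset n → Automorphism H → Subset n → Subset n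
ψ A B φ R = tabulate λ v →
  (lookup R v ∧ (lookup A v ∨ isFixed φ v)) ∨
  (lookup R (from φ v) ∧ lookup A (from φ v))

-- Write a map w : V(H) → V(G) as its restrictions a, f, b to A, F_φ and B. As F_φ separates A from B,
-- w is a homomorphism sending S to a single vertex x iff a ∪ f and f ∪ b are homomorphisms on H[A ∪ F_φ]
-- and H[B ∪ F_φ] sending S ∩ A, S ∩ F_φ and S ∩ B to x. Hence
--   hom(H,G;S) = Σ_{f,x} E_A(S) [S ∩ F_φ ↦ x] E_B(S),
-- where E_X(S) counts the extensions of f to X ∪ F_φ sending S ∩ X to x. The set ψ_{A,B,φ}(R) agrees with R
-- on A ∪ F_φ and meets B in φ(R ∩ A), so transporting along φ, which swaps A and B and fixes F_φ, gives
-- E_B(ψ_{A,B,φ}(R)) = E_A(R); symmetrically for ψ_{B,A,φ}(R). With u = [R ∩ F_φ ↦ x] E_A(R) and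
-- v = [R ∩ F_φ ↦ x] E_B(R) the three counts are Σ uv, Σ u² and Σ v², and Cauchy–Schwarz concludes.

module Submission where

open import Defs hiding (sym)
open import Data.Nat using (ℕ; zero; suc; _+_; _*_; _^_; _∸_; _≤_; z≤n; NonZero)
open import Data.Nat.Properties hiding (_≟_)
open import Data.Nat.ListAction using (sum)
open import Data.Nat.ListAction.Properties using (sum-++)
open import Data.Nat.Tactic.RingSolver using (solve-∀)
open import Data.Bool using (Bool; true; false; T; _∧_; _∨_; not; if_then_else_)
open import Data.Bool.Properties using (T-∧; T-∨; T-≡)
open import Data.Fin using (Fin; zero; suc)
open import Data.Fin.Properties using (_≟_; all?)
open import Data.Vec using (Vec; []; _∷_; lookup; tabulate)
open import Data.Vec.Properties
  using (≡-dec; []=⇒lookup; lookup⇒[]=; lookup∘tabulate; tabulate∘lookup; tabulate-cong)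
open import Data.List as List using (List; []; _∷_; _++_; map; concatMap; allFin)
open import Data.List.Properties using (map-++; map-cong; map-∘; map-tabulate)
open import Data.Product as Product using (_×_; _,_; proj₁; proj₂; uncurry)
open import Data.Empty using (⊥-elim)
open import Data.Fin.Subset using (Subset; _∈_)
open import Relation.Nullary using (¬_)
open import Data.Sum as Sum using (_⊎_; inj₁; inj₂; [_,_]′)
open import Function using (_∘_; _⇔_; mk⇔)
import Function.Bundles
open import Relation.Nullary.Decidable
  using (Dec; does; proof; does-⇔; dec-false; T?; _→-dec_; _×-dec_; ⌊_⌋; toWitness; fromWitness)
open import Relation.Nullary.Reflects using (det; fromEquivalence)
open import Data.Bool.ListAction using (all)
open import Data.List.Relation.Unary.All as All using ()
open import Data.List.Relation.Unary.All.Properties using (all⁺; all⁻; tabulate⁺)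
open import Data.List.Membership.Propositional.Properties using (∈-allFin)
open import Relation.Binary.PropositionalEquality
open import Relation.Binary.Definitions using (DecidableEquality)
open import Algebra.Properties.Semiring.Sum +-*-semiring
  using (sum-syntax; sum-cong-≗; ∑-comm; ∑-distrib-+; *-distribˡ-sum; *-distribʳ-sum)

module ⇔ = Function.Bundles.Equivalence

-- Indicators and Boolean reflection

𝟙 : Bool → ℕ
𝟙 b = if b then 1 else 0

𝟙[_] : ∀ {P : Set} → Dec P → ℕ
𝟙[ P? ] = 𝟙 (does P?)

𝟙-∧ : ∀ a b → 𝟙 (a ∧ b) ≡ 𝟙 a * 𝟙 b
𝟙-∧ false b = refl
𝟙-∧ true  b = sym (+-identityʳ (𝟙 b))

𝟙-idem : ∀ a → 𝟙 a * 𝟙 a ≡ 𝟙 a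
𝟙-idem false = refl
𝟙-idem true  = refl

𝟙-∧-≤ : ∀ a b → 𝟙 (a ∧ b) ≤ 𝟙 a
𝟙-∧-≤ false b     = z≤n
𝟙-∧-≤ true  false = z≤n
𝟙-∧-≤ true  true  = ≤-refl

𝟙-cong : ∀ {P Q : Set} → P ⇔ Q → (P? : Dec P) (Q? : Dec Q) → 𝟙[ P? ] ≡ 𝟙[ Q? ]
𝟙-cong P⇔Q P? Q? = cong 𝟙 (does-⇔ P⇔Q P? Q?)

≡-does : ∀ {b} {P : Set} → T b ⇔ P → (P? : Dec P) → b ≡ does P?
≡-does T⇔P P? = det (fromEquivalence (⇔.to T⇔P) (⇔.from T⇔P)) (proof P?)

T-⇒ : ∀ {a b} → T (not a ∨ b) ⇔ (T a → T b)
T-⇒ {false} = mk⇔ (λ _ ()) _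
T-⇒ {true}  = mk⇔ (λ t _ → t) (λ f → f _)

T-all-allFin : ∀ {n} (p : Fin n → Bool) → T (all p (allFin n)) ⇔ (∀ i → T (p i))
T-all-allFin {n} p = mk⇔ (λ t i → All.lookup (all⁺ p (allFin n) t) (∈-allFin i))
                         (λ t → all⁻ p (tabulate⁺ t))

∧-intro : ∀ {a b} → T a → T b → T (a ∧ b)
∧-intro Ta Tb = ⇔.from T-∧ (Ta , Tb)

∧-elim : ∀ {a b} → T (a ∧ b) → T a × T b
∧-elim = ⇔.to T-∧

T-∀∀⇒ : ∀ {n} (p q : Fin n → Fin n → Bool) →
        T (all (λ u → all (λ v → not (p u v) ∨ q u v) (allFin n)) (allFin n)) ⇔
        (∀ u v → T (p u v) → T (q u v))
T-∀∀⇒ p q = mk⇔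
  (λ t u v → ⇔.to T-⇒ (⇔.to (T-all-allFin _) (⇔.to (T-all-allFin _) t u) v))
  (λ t → ⇔.from (T-all-allFin _) λ u → ⇔.from (T-all-allFin _) λ v → ⇔.from T-⇒ (t u v))

∈⇒T : ∀ {n} {S : Subset n} {v} → v ∈ S → T (lookup S v)
∈⇒T v∈S = ⇔.from T-≡ ([]=⇒lookup v∈S)

T⇒∈ : ∀ {n} {S : Subset n} {v} → T (lookup S v) → v ∈ S
T⇒∈ {S = S} {v} t = lookup⇒[]= v S (⇔.to T-≡ t)

-- Splicing and permuting vectors

splice : ∀ {A : Set} {k} → Vec Bool k → Vec A k → Vec A k → Vec A k
splice []      []      []      = []
splice (s ∷ S) (x ∷ a) (y ∷ f) = (if s then x else y) ∷ splice S a f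

lookup-splice : ∀ {A : Set} {k} (S : Vec Bool k) (a f : Vec A k) (v : Fin k) →
  lookup (splice S a f) v ≡ (if lookup S v then lookup a v else lookup f v)
lookup-splice (s ∷ S) (x ∷ a) (y ∷ f) zero    = refl
lookup-splice (s ∷ S) (x ∷ a) (y ∷ f) (suc v) = lookup-splice S a f v

permute : ∀ {A : Set} {k} → (Fin k → Fin k) → Vec A k → Vec A k
permute π a = tabulate (lookup a ∘ π)

permute-inverse : ∀ {A : Set} {k} {π ρ : Fin k → Fin k} → (∀ v → π (ρ v) ≡ v) →
                  ∀ (a : Vec A k) → permute ρ (permute π a) ≡ a
permute-inverse {π = π} {ρ} πρ a = begin
  tabulate (λ v → lookup (tabulate (lookup a ∘ π)) (ρ v)) ≡⟨ tabulate-cong (λ v → lookup∘tabulate _ (ρ v)) ⟩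
  tabulate (λ v → lookup a (π (ρ v)))                     ≡⟨ tabulate-cong (λ v → cong (lookup a) (πρ v)) ⟩
  tabulate (lookup a)                                     ≡⟨ tabulate∘lookup a ⟩
  a                                                       ∎
  where open ≡-Reasoning

splice-in : ∀ {A : Set} {k} (S : Vec Bool k) (a f : Vec A k) {v} → T (lookup S v) →
            lookup (splice S a f) v ≡ lookup a v
splice-in S a f {v} Sv =
  trans (lookup-splice S a f v) (cong (if_then lookup a v else lookup f v) (⇔.to T-≡ Sv))

splice-out : ∀ {A : Set} {k} (S : Vec Bool k) (a f : Vec A k) {v} → lookup S v ≡ false →
             lookup (splice S a f) v ≡ lookup f v
splice-out S a f {v} ¬Sv =
  trans (lookup-splice S a f v) (cong (if_then lookup a v else lookup f v) ¬Sv)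

-- Finite sums

∑-mono : ∀ {n} {F G : Fin n → ℕ} → (∀ i → F i ≤ G i) → ∑[ i < n ] F i ≤ ∑[ i < n ] G i
∑-mono {zero}  e = z≤n
∑-mono {suc n} e = +-mono-≤ (e zero) (∑-mono (e ∘ suc))

∑-const : ∀ n c → ∑[ i < n ] c ≡ n * c
∑-const zero    c = refl
∑-const (suc n) c = cong (c +_) (∑-const n c)

∑-δ : ∀ {n} (j : Fin n) (F : Fin n → ℕ) → ∑[ i < n ] (𝟙[ i ≟ j ] * F i) ≡ F j
∑-δ {suc n} zero F = begin
  1 * F zero + ∑[ i < n ] 0 ≡⟨ cong₂ _+_ (*-identityˡ (F zero)) (∑-const n 0) ⟩
  F zero + n * 0           ≡⟨ cong (F zero +_) (*-zeroʳ n) ⟩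
  F zero + 0               ≡⟨ +-identityʳ (F zero) ⟩
  F zero                   ∎
  where open ≡-Reasoning
∑-δ {suc n} (suc j) F = ∑-δ j (F ∘ suc)

∑∑-if : ∀ {g} s (F : Fin g → ℕ) → ∑[ x < g ] ∑[ y < g ] F (if s then x else y) ≡ g * ∑[ z < g ] F z
∑∑-if {g} true  F = trans (sum-cong-≗ (λ x → ∑-const g (F x))) (sym (*-distribˡ-sum g F))
∑∑-if {g} false F = ∑-const g (∑[ z < g ] F z)

2[m*n]≤m*m+n*n : ∀ m n → 2 * (m * n) ≤ m * m + n * n
2[m*n]≤m*m+n*n m n = [ ordered , flipped ]′ (≤-total m n)
  where
  square-gap : ∀ m d → 2 * (m * (m + d)) + d * d ≡ m * m + (m + d) * (m + d)
  square-gap = solve-∀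
  ordered : ∀ {m n} → m ≤ n → 2 * (m * n) ≤ m * m + n * n
  ordered {m} {n} m≤n = subst (λ n → 2 * (m * n) ≤ m * m + n * n) (m+[n∸m]≡n m≤n)
    (subst (2 * (m * (m + (n ∸ m))) ≤_) (square-gap m (n ∸ m)) (m≤m+n _ ((n ∸ m) * (n ∸ m))))
  flipped : n ≤ m → 2 * (m * n) ≤ m * m + n * n
  flipped n≤m = subst₂ _≤_ (cong (2 *_) (*-comm n m)) (+-comm (n * n) (m * m)) (ordered n≤m)

∑ᵛ : ∀ {g} k → (Vec (Fin g) k → ℕ) → ℕ
∑ᵛ zero    F = F []
∑ᵛ {g} (suc k) F = ∑ᵛ k (λ xs → ∑[ x < g ] F (x ∷ xs))

module _ {g : ℕ} where

  private
    V : ℕ → Set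
    V = Vec (Fin g)

  ∑ᵛ-cong : ∀ k {F G : V k → ℕ} → (∀ w → F w ≡ G w) → ∑ᵛ k F ≡ ∑ᵛ k G
  ∑ᵛ-cong zero    e = e []
  ∑ᵛ-cong (suc k) e = ∑ᵛ-cong k (λ xs → sum-cong-≗ (λ x → e (x ∷ xs)))

  ∑ᵛ-mono : ∀ k {F G : V k → ℕ} → (∀ w → F w ≤ G w) → ∑ᵛ k F ≤ ∑ᵛ k G
  ∑ᵛ-mono zero    e = e []
  ∑ᵛ-mono (suc k) e = ∑ᵛ-mono k (λ xs → ∑-mono (λ x → e (x ∷ xs)))

  ∑ᵛ-distrib-+ : ∀ k (F G : V k → ℕ) → ∑ᵛ k (λ w → F w + G w) ≡ ∑ᵛ k F + ∑ᵛ k G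
  ∑ᵛ-distrib-+ zero    F G = refl
  ∑ᵛ-distrib-+ (suc k) F G =
    trans (∑ᵛ-cong k (λ xs → ∑-distrib-+ (λ x → F (x ∷ xs)) (λ x → G (x ∷ xs)))) (∑ᵛ-distrib-+ k _ _)

  *-distribˡ-∑ᵛ : ∀ k c (F : V k → ℕ) → c * ∑ᵛ k F ≡ ∑ᵛ k (λ w → c * F w)
  *-distribˡ-∑ᵛ zero    c F = refl
  *-distribˡ-∑ᵛ (suc k) c F =
    trans (*-distribˡ-∑ᵛ k c _) (∑ᵛ-cong k (λ xs → *-distribˡ-sum c (λ x → F (x ∷ xs))))

  *-distribʳ-∑ᵛ : ∀ k c (F : V k → ℕ) → ∑ᵛ k F * c ≡ ∑ᵛ k (λ w → F w * c)
  *-distribʳ-∑ᵛ zero    c F = refl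
  *-distribʳ-∑ᵛ (suc k) c F =
    trans (*-distribʳ-∑ᵛ k c _) (∑ᵛ-cong k (λ xs → *-distribʳ-sum c (λ x → F (x ∷ xs))))

  ∑ᵛ-∑-comm : ∀ k (F : V k → Fin g → ℕ) →
              ∑ᵛ k (λ w → ∑[ x < g ] F w x) ≡ ∑[ x < g ] ∑ᵛ k (λ w → F w x)
  ∑ᵛ-∑-comm zero    F = refl
  ∑ᵛ-∑-comm (suc k) F = trans (∑ᵛ-cong k (λ xs → ∑-comm (λ y x → F (y ∷ xs) x))) (∑ᵛ-∑-comm k _)

  ∑ᵛ-comm : ∀ k m (F : V k → V m → ℕ) →
            ∑ᵛ k (λ v → ∑ᵛ m (λ w → F v w)) ≡ ∑ᵛ m (λ w → ∑ᵛ k (λ v → F v w))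
  ∑ᵛ-comm zero    m F = refl
  ∑ᵛ-comm (suc k) m F =
    trans (∑ᵛ-cong k (λ xs → sym (∑ᵛ-∑-comm m _))) (∑ᵛ-comm k m _)

  _≟ᵛ_ : ∀ {k} → DecidableEquality (V k)
  _≟ᵛ_ = ≡-dec _≟_

  ∑ᵛ-δ : ∀ k (w : V k) (F : V k → ℕ) → ∑ᵛ k (λ v → 𝟙[ v ≟ᵛ w ] * F v) ≡ F w
  ∑ᵛ-δ zero    []       F = +-identityʳ (F [])
  ∑ᵛ-δ (suc k) (y ∷ ys) F = trans (∑ᵛ-cong k inner) (∑ᵛ-δ k ys (λ xs → F (y ∷ xs)))
    where
    open ≡-Reasoning
    inner : ∀ xs → ∑[ x < g ] (𝟙 (does (x ≟ y) ∧ does (xs ≟ᵛ ys)) * F (x ∷ xs))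
                 ≡ 𝟙[ xs ≟ᵛ ys ] * F (y ∷ xs)
    inner xs = begin
      ∑[ x < g ] (𝟙 (does (x ≟ y) ∧ δ) * F (x ∷ xs))
        ≡⟨ sum-cong-≗ (λ x → trans (cong (_* F (x ∷ xs)) (trans (𝟙-∧ (does (x ≟ y)) δ) (*-comm _ (𝟙 δ))))
                                 (*-assoc (𝟙 δ) (𝟙[ x ≟ y ]) (F (x ∷ xs)))) ⟩
      ∑[ x < g ] (𝟙 δ * (𝟙[ x ≟ y ] * F (x ∷ xs)))
        ≡⟨ *-distribˡ-sum (𝟙 δ) (λ x → 𝟙[ x ≟ y ] * F (x ∷ xs)) ⟨
      𝟙 δ * ∑[ x < g ] (𝟙[ x ≟ y ] * F (x ∷ xs))
        ≡⟨ cong (𝟙 δ *_) (∑-δ y (λ x → F (x ∷ xs))) ⟩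
      𝟙 δ * F (y ∷ xs) ∎
      where δ = does (xs ≟ᵛ ys)

  ∑ᵛ-reindex : ∀ k (σ τ : V k → V k) → (∀ v → τ (σ v) ≡ v) → (∀ w → σ (τ w) ≡ w) →
               (F : V k → ℕ) → ∑ᵛ k (λ v → F (σ v)) ≡ ∑ᵛ k F
  ∑ᵛ-reindex k σ τ τσ στ F = begin
    ∑ᵛ k (λ v → F (σ v))
      ≡⟨ ∑ᵛ-cong k (λ v → ∑ᵛ-δ k (σ v) F) ⟨
    ∑ᵛ k (λ v → ∑ᵛ k (λ w → 𝟙[ w ≟ᵛ σ v ] * F w))
      ≡⟨ ∑ᵛ-comm k k _ ⟩
    ∑ᵛ k (λ w → ∑ᵛ k (λ v → 𝟙[ w ≟ᵛ σ v ] * F w))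
      ≡⟨ ∑ᵛ-cong k (λ w → ∑ᵛ-cong k (λ v →
           cong (λ b → 𝟙 b * F w) (does-⇔ (transpose v w) (w ≟ᵛ σ v) (v ≟ᵛ τ w)))) ⟩
    ∑ᵛ k (λ w → ∑ᵛ k (λ v → 𝟙[ v ≟ᵛ τ w ] * F w))
      ≡⟨ ∑ᵛ-cong k (λ w → ∑ᵛ-δ k (τ w) (λ _ → F w)) ⟩
    ∑ᵛ k F ∎
    where
    open ≡-Reasoning
    transpose : ∀ v w → (w ≡ σ v) ⇔ (v ≡ τ w)
    transpose v w = mk⇔ (λ e → trans (sym (τσ v)) (cong τ (sym e)))
                        (λ e → trans (sym (στ w)) (cong σ (sym e)))

  ∑ᵛ-permute : ∀ k (π ρ : Fin k → Fin k) → (∀ v → π (ρ v) ≡ v) → (∀ v → ρ (π v) ≡ v) →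
               (F : V k → ℕ) → ∑ᵛ k (λ a → F (permute π a)) ≡ ∑ᵛ k F
  ∑ᵛ-permute k π ρ πρ ρπ = ∑ᵛ-reindex k (permute π) (permute ρ) (permute-inverse πρ) (permute-inverse ρπ)

  ∑ᵛ-zero : ∀ k → ∑ᵛ k (λ (_ : V k) → 0) ≡ 0
  ∑ᵛ-zero k = sym (*-distribˡ-∑ᵛ k 0 (λ _ → 0))

  ∑ᵛ-splice : ∀ k (S : Vec Bool k) (F : V k → ℕ) →
              ∑ᵛ k (λ a → ∑ᵛ k (λ f → F (splice S a f))) ≡ g ^ k * ∑ᵛ k F
  ∑ᵛ-splice zero    []      F = sym (+-identityʳ (F []))
  ∑ᵛ-splice (suc k) (s ∷ S) F = begin
    ∑ᵛ k (λ as → ∑[ x < g ] ∑ᵛ k (λ fs → ∑[ y < g ] F ((if s then x else y) ∷ splice S as fs)))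
      ≡⟨ ∑ᵛ-cong k (λ as → ∑ᵛ-∑-comm k _) ⟨
    ∑ᵛ k (λ as → ∑ᵛ k (λ fs → ∑[ x < g ] ∑[ y < g ] F ((if s then x else y) ∷ splice S as fs)))
      ≡⟨ ∑ᵛ-cong k (λ as → ∑ᵛ-cong k (λ fs → ∑∑-if s (λ z → F (z ∷ splice S as fs)))) ⟩
    ∑ᵛ k (λ as → ∑ᵛ k (λ fs → g * F′ (splice S as fs)))
      ≡⟨ ∑ᵛ-cong k (λ as → *-distribˡ-∑ᵛ k g _) ⟨
    ∑ᵛ k (λ as → g * ∑ᵛ k (λ fs → F′ (splice S as fs)))
      ≡⟨ *-distribˡ-∑ᵛ k g _ ⟨
    g * ∑ᵛ k (λ as → ∑ᵛ k (λ fs → F′ (splice S as fs)))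
      ≡⟨ cong (g *_) (∑ᵛ-splice k S F′) ⟩
    g * (g ^ k * ∑ᵛ k F′)
      ≡⟨ *-assoc g (g ^ k) _ ⟨
    g ^ suc k * ∑ᵛ (suc k) F ∎
    where
    open ≡-Reasoning
    F′ : V k → ℕ
    F′ w = ∑[ z < g ] F (z ∷ w)

  ∑ᵛ-splice² : ∀ k (A B : Vec Bool k) (F : V k → ℕ) →
    ∑ᵛ k (λ a → ∑ᵛ k (λ b → ∑ᵛ k (λ f → F (splice A a (splice B b f))))) ≡ (g ^ k * g ^ k) * ∑ᵛ k F
  ∑ᵛ-splice² k A B F = begin
    ∑ᵛ k (λ a → ∑ᵛ k (λ b → ∑ᵛ k (λ f → F (splice A a (splice B b f)))))
      ≡⟨ ∑ᵛ-cong k (λ a → ∑ᵛ-splice k B (λ c → F (splice A a c))) ⟩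
    ∑ᵛ k (λ a → g ^ k * ∑ᵛ k (λ c → F (splice A a c)))
      ≡⟨ *-distribˡ-∑ᵛ k (g ^ k) _ ⟨
    g ^ k * ∑ᵛ k (λ a → ∑ᵛ k (λ c → F (splice A a c)))
      ≡⟨ cong (g ^ k *_) (∑ᵛ-splice k A F) ⟩
    g ^ k * (g ^ k * ∑ᵛ k F)
      ≡⟨ *-assoc (g ^ k) (g ^ k) _ ⟨
    (g ^ k * g ^ k) * ∑ᵛ k F ∎
    where open ≡-Reasoning

  ∑ᵛ-factor : ∀ k (P Q : V k → V k → Fin g → ℕ) (M : V k → Fin g → ℕ) →
    ∑ᵛ k (λ a → ∑ᵛ k (λ b → ∑ᵛ k (λ f → ∑[ x < g ] (P a f x * (M f x * Q b f x)))))
    ≡ ∑ᵛ k (λ f → ∑[ x < g ] (∑ᵛ k (λ a → P a f x) * (M f x * ∑ᵛ k (λ b → Q b f x))))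
  ∑ᵛ-factor k P Q M = begin
    ∑ᵛ k (λ a → ∑ᵛ k (λ b → ∑ᵛ k (λ f → ∑[ x < g ] Π a b f x)))
      ≡⟨ ∑ᵛ-cong k (λ a → ∑ᵛ-comm k k _) ⟩
    ∑ᵛ k (λ a → ∑ᵛ k (λ f → ∑ᵛ k (λ b → ∑[ x < g ] Π a b f x)))
      ≡⟨ ∑ᵛ-comm k k _ ⟩
    ∑ᵛ k (λ f → ∑ᵛ k (λ a → ∑ᵛ k (λ b → ∑[ x < g ] Π a b f x)))
      ≡⟨ ∑ᵛ-cong k (λ f → trans (∑ᵛ-cong k (λ a → ∑ᵛ-∑-comm k _)) (∑ᵛ-∑-comm k _)) ⟩
    ∑ᵛ k (λ f → ∑[ x < g ] ∑ᵛ k (λ a → ∑ᵛ k (λ b → Π a b f x)))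
      ≡⟨ ∑ᵛ-cong k (λ f → sum-cong-≗ (λ x → factor f x)) ⟩
    ∑ᵛ k (λ f → ∑[ x < g ] (∑ᵛ k (λ a → P a f x) * (M f x * ∑ᵛ k (λ b → Q b f x)))) ∎
    where
    open ≡-Reasoning
    Π : _ → _ → _ → Fin g → ℕ
    Π a b f x = P a f x * (M f x * Q b f x)
    factor : ∀ f x → ∑ᵛ k (λ a → ∑ᵛ k (λ b → Π a b f x))
                   ≡ ∑ᵛ k (λ a → P a f x) * (M f x * ∑ᵛ k (λ b → Q b f x))
    factor f x = begin
      ∑ᵛ k (λ a → ∑ᵛ k (λ b → P a f x * (M f x * Q b f x)))
        ≡⟨ ∑ᵛ-cong k (λ a → trans (sym (*-distribˡ-∑ᵛ k (P a f x) _))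
                                  (cong (P a f x *_) (sym (*-distribˡ-∑ᵛ k (M f x) _)))) ⟩
      ∑ᵛ k (λ a → P a f x * (M f x * ∑ᵛ k (λ b → Q b f x)))
        ≡⟨ *-distribʳ-∑ᵛ k _ (λ a → P a f x) ⟨
      ∑ᵛ k (λ a → P a f x) * (M f x * ∑ᵛ k (λ b → Q b f x)) ∎

  ∑ᵛ-*-∑ᵛ : ∀ k (F G : V k → ℕ) → ∑ᵛ k F * ∑ᵛ k G ≡ ∑ᵛ k (λ i → ∑ᵛ k (λ j → F i * G j))
  ∑ᵛ-*-∑ᵛ k F G = trans (*-distribʳ-∑ᵛ k (∑ᵛ k G) F) (∑ᵛ-cong k (λ i → *-distribˡ-∑ᵛ k (F i) G))

  cauchy-schwarz : ∀ k (u v : V k → ℕ) →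
    ∑ᵛ k (λ i → u i * v i) * ∑ᵛ k (λ i → u i * v i) ≤ ∑ᵛ k (λ i → u i * u i) * ∑ᵛ k (λ i → v i * v i)
  cauchy-schwarz k u v = *-cancelˡ-≤ 2 (begin
    2 * (∑ᵛ k uv * ∑ᵛ k uv)
      ≡⟨ cong (2 *_) (∑ᵛ-*-∑ᵛ k uv uv) ⟩
    2 * ∑ᵛ k (λ i → ∑ᵛ k (λ j → uv i * uv j))
      ≡⟨ trans (*-distribˡ-∑ᵛ k 2 _) (∑ᵛ-cong k (λ i → *-distribˡ-∑ᵛ k 2 _)) ⟩
    ∑ᵛ k (λ i → ∑ᵛ k (λ j → 2 * (uv i * uv j)))
      ≤⟨ ∑ᵛ-mono k (λ i → ∑ᵛ-mono k (λ j → pointwise i j)) ⟩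
    ∑ᵛ k (λ i → ∑ᵛ k (λ j → uu i * vv j + uu j * vv i))
      ≡⟨ trans (∑ᵛ-cong k (λ i → ∑ᵛ-distrib-+ k _ _)) (∑ᵛ-distrib-+ k _ _) ⟩
    ∑ᵛ k (λ i → ∑ᵛ k (λ j → uu i * vv j)) + ∑ᵛ k (λ i → ∑ᵛ k (λ j → uu j * vv i))
      ≡⟨ cong (∑ᵛ k (λ i → ∑ᵛ k (λ j → uu i * vv j)) +_) (∑ᵛ-comm k k (λ i j → uu j * vv i)) ⟩
    ∑ᵛ k (λ i → ∑ᵛ k (λ j → uu i * vv j)) + ∑ᵛ k (λ j → ∑ᵛ k (λ i → uu j * vv i))
      ≡⟨ cong₂ _+_ (sym (∑ᵛ-*-∑ᵛ k uu vv)) (trans (sym (∑ᵛ-*-∑ᵛ k uu vv)) (sym (+-identityʳ _))) ⟩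
    2 * (∑ᵛ k uu * ∑ᵛ k vv) ∎)
    where
    open ≤-Reasoning
    uv uu vv : V k → ℕ
    uv i = u i * v i
    uu i = u i * u i
    vv i = v i * v i
    regroup₁ : ∀ a b c d → 2 * ((a * d) * (c * b)) ≡ 2 * ((a * b) * (c * d))
    regroup₁ = solve-∀
    regroup₂ : ∀ a b c d → (a * d) * (a * d) + (c * b) * (c * b) ≡ (a * a) * (d * d) + (c * c) * (b * b)
    regroup₂ = solve-∀
    pointwise : ∀ i j → 2 * (uv i * uv j) ≤ uu i * vv j + uu j * vv i
    pointwise i j = subst₂ _≤_ (regroup₁ (u i) (v i) (u j) (v j)) (regroup₂ (u i) (v i) (u j) (v j))
                      (2[m*n]≤m*m+n*n (u i * v j) (u j * v i))

sum-tabulate : ∀ {n} (F : Fin n → ℕ) → sum (List.tabulate F) ≡ ∑[ i < n ] F i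
sum-tabulate {zero}  F = refl
sum-tabulate {suc n} F = cong (F zero +_) (sum-tabulate (F ∘ suc))

sum-map-concatMap : ∀ {A B : Set} (f : A → List B) (F : B → ℕ) (xs : List A) →
  sum (map F (concatMap f xs)) ≡ sum (map (λ a → sum (map F (f a))) xs)
sum-map-concatMap f F []       = refl
sum-map-concatMap f F (x ∷ xs) = begin
  sum (map F (f x ++ concatMap f xs))
    ≡⟨ cong sum (map-++ F (f x) (concatMap f xs)) ⟩
  sum (map F (f x) ++ map F (concatMap f xs))
    ≡⟨ sum-++ (map F (f x)) _ ⟩
  sum (map F (f x)) + sum (map F (concatMap f xs))
    ≡⟨ cong (sum (map F (f x)) +_) (sum-map-concatMap f F xs) ⟩
  sum (map F (f x)) + sum (map (λ a → sum (map F (f a))) xs) ∎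
  where open ≡-Reasoning

sum-allVecs : ∀ k {g} (F : Vec (Fin g) k → ℕ) → sum (map F (allVecs k g)) ≡ ∑ᵛ k F
sum-allVecs zero    F = +-identityʳ (F [])
sum-allVecs (suc k) {g} F = begin
  sum (map F (allVecs (suc k) g))
    ≡⟨ sum-map-concatMap (λ xs → map (_∷ xs) (allFin g)) F (allVecs k g) ⟩
  sum (map (λ xs → sum (map F (map (_∷ xs) (allFin g)))) (allVecs k g))
    ≡⟨ cong sum (map-cong sum-row (allVecs k g)) ⟩
  sum (map (λ xs → ∑[ x < g ] F (x ∷ xs)) (allVecs k g))
    ≡⟨ sum-allVecs k _ ⟩
  ∑ᵛ (suc k) F ∎
  where
  open ≡-Reasoning
  sum-row : ∀ xs → sum (map F (map (_∷ xs) (allFin g))) ≡ ∑[ x < g ] F (x ∷ xs)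
  sum-row xs = trans (cong sum (trans (sym (map-∘ (allFin g))) (map-tabulate (λ x → x) _)))
                     (sum-tabulate (λ x → F (x ∷ xs)))

-- Homomorphisms

module _ {h g : ℕ} where

  MapsTo : (Fin h → Bool) → (Fin h → Fin g) → Fin g → Set
  MapsTo P f x = ∀ v → T (P v) → f v ≡ x

  mapsTo? : ∀ P f x → Dec (MapsTo P f x)
  mapsTo? P f x = all? λ v → T? (P v) →-dec f v ≟ x

  Collapses : (Fin h → Bool) → (Fin h → Fin g) → Set
  Collapses P f = ∀ u v → T (P u) → T (P v) → f u ≡ f v

  T-collapses : ∀ S f → T (collapses S f) ⇔ Collapses (lookup S) f
  T-collapses S f = mk⇔
    (λ t u v Su Sv → toWitness (⇔.to T-∀∀⇒S t u v (∧-intro Su Sv)))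
    (λ c → ⇔.from T-∀∀⇒S λ u v t → fromWitness (uncurry (c u v) (∧-elim t)))
    where
    T-∀∀⇒S = T-∀∀⇒ (λ u v → lookup S u ∧ lookup S v) (λ u v → ⌊ f u ≟ f v ⌋)

  MapsTo⇔≡×Collapses : ∀ {P f x s} → T (P s) → MapsTo P f x ⇔ (x ≡ f s × Collapses P f)
  MapsTo⇔≡×Collapses {s = s} Ps = mk⇔
    (λ m → sym (m s Ps) , λ u v Pu Pv → trans (m u Pu) (sym (m v Pv)))
    (λ { (x≡fs , c) v Pv → trans (c v s Pv Ps) (sym x≡fs) })

  Agree : (Fin h → Bool) → (Fin h → Fin g) → (Fin h → Fin g) → Set
  Agree P f f′ = ∀ v → T (P v) → f v ≡ f′ v

  agree-sym : ∀ {P f f′} → Agree P f f′ → Agree P f′ f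
  agree-sym f≈f′ v Pv = sym (f≈f′ v Pv)

  MapsTo-⊆ : ∀ {P Q f x} → (∀ v → T (Q v) → T (P v)) → MapsTo P f x → MapsTo Q f x
  MapsTo-⊆ Q⊆P m v Qv = m v (Q⊆P v Qv)

  MapsTo-∘ : ∀ {P f x} (π : Fin h → Fin h) → MapsTo P f x → MapsTo (P ∘ π) (f ∘ π) x
  MapsTo-∘ π m v = m (π v)

  MapsTo-agree : ∀ {P f f′ x} → Agree P f f′ → MapsTo P f x → MapsTo P f′ x
  MapsTo-agree f≈f′ m v Pv = trans (sym (f≈f′ v Pv)) (m v Pv)

  collapses? : ∀ P f → Dec (Collapses P f)
  collapses? P f = all? λ u → all? λ v → T? (P u) →-dec T? (P v) →-dec f u ≟ f v

  𝟙-collapses-∑ : ∀ {Q : Set} (Q? : Dec Q) P f {s} → T (P s) →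
                  𝟙[ Q? ×-dec collapses? P f ] ≡ ∑[ x < g ] 𝟙[ Q? ×-dec mapsTo? P f x ]
  𝟙-collapses-∑ {Q} Q? P f {s} Ps = sym (begin
    ∑[ x < g ] 𝟙[ Q? ×-dec mapsTo? P f x ]
      ≡⟨ sum-cong-≗ (λ x → 𝟙-cong (regroup x) (Q? ×-dec mapsTo? P f x)
                                                ((x ≟ f s) ×-dec (Q? ×-dec collapses? P f))) ⟩
    ∑[ x < g ] 𝟙[ (x ≟ f s) ×-dec (Q? ×-dec collapses? P f) ]
      ≡⟨ sum-cong-≗ (λ x → 𝟙-∧ (does (x ≟ f s)) _) ⟩
    ∑[ x < g ] (𝟙[ x ≟ f s ] * 𝟙[ Q? ×-dec collapses? P f ])
      ≡⟨ ∑-δ (f s) (λ _ → 𝟙[ Q? ×-dec collapses? P f ]) ⟩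
    𝟙[ Q? ×-dec collapses? P f ] ∎)
    where
    open ≡-Reasoning
    regroup : ∀ x → (Q × MapsTo P f x) ⇔ (x ≡ f s × (Q × Collapses P f))
    regroup x = mk⇔
      (λ (q , m) → let e , c = ⇔.to (MapsTo⇔≡×Collapses Ps) m in e , q , c)
      (λ (e , q , c) → q , ⇔.from (MapsTo⇔≡×Collapses Ps) (e , c))

  module _ (H : Graph h) (G : Graph g) where

    IsHom : (Fin h → Fin g) → Set
    IsHom f = ∀ u v → T (adj H u v) → T (adj G (f u) (f v))

    isHom? : ∀ f → Dec (IsHom f)
    isHom? f = all? λ u → all? λ v → T? (adj H u v) →-dec T? (adj G (f u) (f v))

    HomOn : (Fin h → Bool) → (Fin h → Fin g) → Set
    HomOn P f = ∀ u v → T (P u) → T (P v) → T (adj H u v) → T (adj G (f u) (f v))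

    homOn? : ∀ P f → Dec (HomOn P f)
    homOn? P f = all? λ u → all? λ v →
      T? (P u) →-dec T? (P v) →-dec T? (adj H u v) →-dec T? (adj G (f u) (f v))

    T-isHom : ∀ f → T (isHom H G f) ⇔ IsHom f
    T-isHom f = T-∀∀⇒ _ _

    homR-as-∑ᵛ : ∀ S → homR H G S ≡ ∑ᵛ h (λ w → 𝟙[ isHom? (lookup w) ×-dec collapses? (lookup S) (lookup w) ])
    homR-as-∑ᵛ S = trans (sum-allVecs h _) (∑ᵛ-cong h (λ w →
      cong 𝟙 (cong₂ _∧_ (≡-does (T-isHom _) (isHom? _)) (≡-does (T-collapses S _) (collapses? _ _)))))

    HomOn-agree : ∀ {P f f′} → Agree P f f′ → HomOn P f → HomOn P f′
    HomOn-agree f≈f′ hom u v Pu Pv uv =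
      subst₂ (λ p q → T (adj G p q)) (f≈f′ u Pu) (f≈f′ v Pv) (hom u v Pu Pv uv)

    HomOn-⊆ : ∀ {P Q f} → (∀ v → T (Q v) → T (P v)) → HomOn P f → HomOn Q f
    HomOn-⊆ Q⊆P hom u v Qu Qv = hom u v (Q⊆P u Qu) (Q⊆P v Qv)

    HomOn-∘ : ∀ {P f} (π : Fin h → Fin h) → (∀ u v → T (adj H u v) → T (adj H (π u) (π v))) →
              HomOn P f → HomOn (P ∘ π) (f ∘ π)
    HomOn-∘ π π-adj hom u v Pπu Pπv uv = hom (π u) (π v) Pπu Pπv (π-adj u v uv)

    IsHom⇔HomOn×HomOn : ∀ {P Q} →
      (∀ {u v} → T (adj H u v) → (T (P u) × T (P v)) ⊎ (T (Q u) × T (Q v))) →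
      ∀ f → IsHom f ⇔ (HomOn P f × HomOn Q f)
    IsHom⇔HomOn×HomOn sides f = mk⇔
      (λ hom → (λ u v _ _ → hom u v) , (λ u v _ _ → hom u v))
      (λ (homP , homQ) u v uv → [ (λ (Pu , Pv) → homP u v Pu Pv uv)
                                , (λ (Qu , Qv) → homQ u v Qu Qv uv) ]′ (sides uv))

homR≤hom : ∀ {h g} (H : Graph h) (G : Graph g) S → homR H G S ≤ hom H G
homR≤hom {h} H G S = subst₂ _≤_ (sym (sum-allVecs h _)) (sym (sum-allVecs h _))
  (∑ᵛ-mono h (λ w → 𝟙-∧-≤ (isHom H G (lookup w)) _))

homR-empty : ∀ {h} (H : Graph h) (G : Graph 0) S → Fin h → homR H G S ≡ 0
homR-empty {suc k} H G S _ = trans (sum-allVecs (suc k) _) (∑ᵛ-zero k)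

-- Factorisation over a separating set

_∩ᵇ_ _∪ᵇ_ : ∀ {h} → Subset h → (Fin h → Bool) → Fin h → Bool
(S ∩ᵇ P) v = lookup S v ∧ P v
(S ∪ᵇ P) v = lookup S v ∨ P v

∪ᵇ-inj₁ : ∀ {h} (S : Subset h) P {v} → T (lookup S v) → T ((S ∪ᵇ P) v)
∪ᵇ-inj₁ S P p = ⇔.from T-∨ (inj₁ p)

∪ᵇ-inj₂ : ∀ {h} (S : Subset h) P {v} → T (P v) → T ((S ∪ᵇ P) v)
∪ᵇ-inj₂ S P p = ⇔.from T-∨ (inj₂ p)

record Separation {h} (H : Graph h) (A B : Subset h) (F : Fin h → Bool) : Set where
  field
    cover           : ∀ v → T (lookup A v) ⊎ T (lookup B v) ⊎ T (F v)
    B⇒∉A            : ∀ {v} → T (lookup B v) → lookup A v ≡ false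
    F⇒∉A            : ∀ {v} → T (F v) → lookup A v ≡ false
    F⇒∉B            : ∀ {v} → T (F v) → lookup B v ≡ false
    A-B-nonadjacent : ∀ {u v} → T (lookup A u) → T (lookup B v) → ¬ T (adj H u v)

module Factorisation {h g} (H : Graph h) (G : Graph g) {A B : Subset h} {F : Fin h → Bool}
                     (sep : Separation H A B F) where
  open Separation sep

  -- A map on X ∪ F is encoded by two full vectors, read on X and off X respectively; the unread
  -- coordinates inflate every count uniformly, which `factorisation` records as the factor g ^ h * g ^ h.
  Extends : Subset h → Subset h → Vec (Fin g) h → Vec (Fin g) h → Fin g → Set
  Extends X S a f x = HomOn H G (X ∪ᵇ F) (lookup (splice X a f)) × MapsTo (S ∩ᵇ lookup X) (lookup a) x

  extends? : ∀ X S a f x → Dec (Extends X S a f x)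
  extends? X S a f x = homOn? H G (X ∪ᵇ F) (lookup (splice X a f)) ×-dec mapsTo? (S ∩ᵇ lookup X) (lookup a) x

  extensions : Subset h → Subset h → Vec (Fin g) h → Fin g → ℕ
  extensions X S f x = ∑ᵛ h (λ a → 𝟙[ extends? X S a f x ])

  onSeparator? : ∀ S (f : Vec (Fin g) h) x → Dec (MapsTo (S ∩ᵇ F) (lookup f) x)
  onSeparator? S f x = mapsTo? (S ∩ᵇ F) (lookup f) x

  edge-sides : ∀ {u v} → T (adj H u v) →
               (T ((A ∪ᵇ F) u) × T ((A ∪ᵇ F) v)) ⊎ (T ((B ∪ᵇ F) u) × T ((B ∪ᵇ F) v))
  edge-sides {u} {v} uv with cover u | cover v
  ... | inj₁ Au        | inj₁ Av        = inj₁ (∪ᵇ-inj₁ A F Au , ∪ᵇ-inj₁ A F Av)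
  ... | inj₁ Au        | inj₂ (inj₁ Bv) = ⊥-elim (A-B-nonadjacent Au Bv uv)
  ... | inj₁ Au        | inj₂ (inj₂ Fv) = inj₁ (∪ᵇ-inj₁ A F Au , ∪ᵇ-inj₂ A F Fv)
  ... | inj₂ (inj₁ Bu) | inj₁ Av        = ⊥-elim (A-B-nonadjacent Av Bu (subst T (Graph.sym H u v) uv))
  ... | inj₂ (inj₁ Bu) | inj₂ (inj₁ Bv) = inj₂ (∪ᵇ-inj₁ B F Bu , ∪ᵇ-inj₁ B F Bv)
  ... | inj₂ (inj₁ Bu) | inj₂ (inj₂ Fv) = inj₂ (∪ᵇ-inj₁ B F Bu , ∪ᵇ-inj₂ B F Fv)
  ... | inj₂ (inj₂ Fu) | inj₁ Av        = inj₁ (∪ᵇ-inj₂ A F Fu , ∪ᵇ-inj₁ A F Av)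
  ... | inj₂ (inj₂ Fu) | inj₂ (inj₁ Bv) = inj₂ (∪ᵇ-inj₂ B F Fu , ∪ᵇ-inj₁ B F Bv)
  ... | inj₂ (inj₂ Fu) | inj₂ (inj₂ Fv) = inj₁ (∪ᵇ-inj₂ A F Fu , ∪ᵇ-inj₂ A F Fv)

  MapsTo⇔MapsTo³ : ∀ S (w : Fin h → Fin g) x → MapsTo (lookup S) w x ⇔
    (MapsTo (S ∩ᵇ lookup A) w x × MapsTo (S ∩ᵇ F) w x × MapsTo (S ∩ᵇ lookup B) w x)
  MapsTo⇔MapsTo³ S w x = mk⇔
    (λ m → restrict m , restrict m , restrict m)
    (λ (mA , mF , mB) v Sv → [ (λ Av → mA v (∧-intro Sv Av))
                             , [ (λ Bv → mB v (∧-intro Sv Bv))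
                               , (λ Fv → mF v (∧-intro Sv Fv)) ]′ ]′ (cover v))
    where
    restrict : ∀ {P} → MapsTo (lookup S) w x → MapsTo (S ∩ᵇ P) w x
    restrict m v t = m v (proj₁ (∧-elim t))

  module Glue (a b f : Vec (Fin g) h) where

    w : Fin h → Fin g
    w = lookup (splice A a (splice B b f))

    w-on-A : Agree (lookup A) w (lookup a)
    w-on-A v Av = splice-in A a _ Av

    w-on-B : Agree (lookup B) w (lookup b)
    w-on-B v Bv = trans (splice-out A a _ (B⇒∉A Bv)) (splice-in B b f Bv)

    w-on-F : Agree F w (lookup f)
    w-on-F v Fv = trans (splice-out A a _ (F⇒∉A Fv)) (splice-out B b f (F⇒∉B Fv))

    sideA-agree : Agree (A ∪ᵇ F) (lookup (splice A a f)) w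
    sideA-agree v AFv = [ (λ Av → trans (splice-in A a f Av) (sym (w-on-A v Av)))
                        , (λ Fv → trans (splice-out A a f (F⇒∉A Fv)) (sym (w-on-F v Fv))) ]′ (⇔.to T-∨ AFv)

    sideB-agree : Agree (B ∪ᵇ F) (lookup (splice B b f)) w
    sideB-agree v BFv = [ (λ Bv → trans (splice-in B b f Bv) (sym (w-on-B v Bv)))
                        , (λ Fv → trans (splice-out B b f (F⇒∉B Fv)) (sym (w-on-F v Fv))) ]′ (⇔.to T-∨ BFv)

    glue⇔ : ∀ S x → (IsHom H G w × MapsTo (lookup S) w x) ⇔
                    (Extends A S a f x × MapsTo (S ∩ᵇ F) (lookup f) x × Extends B S b f x)
    glue⇔ S x = mk⇔
      (λ (hom , m) →
        let homA , homB = ⇔.to (IsHom⇔HomOn×HomOn H G edge-sides w) hom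
            mA , mF , mB = ⇔.to (MapsTo⇔MapsTo³ S w x) m
        in (HomOn-agree H G (agree-sym sideA-agree) homA , MapsTo-agree (restrict w-on-A) mA)
         , MapsTo-agree (restrict w-on-F) mF
         , (HomOn-agree H G (agree-sym sideB-agree) homB , MapsTo-agree (restrict w-on-B) mB))
      (λ ((homA , mA) , mF , (homB , mB)) →
          ⇔.from (IsHom⇔HomOn×HomOn H G edge-sides w)
            (HomOn-agree H G sideA-agree homA , HomOn-agree H G sideB-agree homB)
        , ⇔.from (MapsTo⇔MapsTo³ S w x)
            ( MapsTo-agree (agree-sym (restrict w-on-A)) mA
            , MapsTo-agree (agree-sym (restrict w-on-F)) mF
            , MapsTo-agree (agree-sym (restrict w-on-B)) mB))
      where
      restrict : ∀ {P f′} → Agree P w f′ → Agree (S ∩ᵇ P) w f′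
      restrict w≈f′ v t = w≈f′ v (proj₂ (∧-elim t))

  factorisation : ∀ S {s} → T (lookup S s) →
    (g ^ h * g ^ h) * homR H G S ≡
    ∑ᵛ h (λ f → ∑[ x < g ] (extensions A S f x * (𝟙[ onSeparator? S f x ] * extensions B S f x)))
  factorisation S Ss = begin
    (g ^ h * g ^ h) * homR H G S
      ≡⟨ cong ((g ^ h * g ^ h) *_) (homR-as-∑ᵛ H G S) ⟩
    (g ^ h * g ^ h) * ∑ᵛ h Ψ
      ≡⟨ ∑ᵛ-splice² h A B Ψ ⟨
    ∑ᵛ h (λ a → ∑ᵛ h (λ b → ∑ᵛ h (λ f → Ψ (splice A a (splice B b f)))))
      ≡⟨ ∑ᵛ-cong h (λ a → ∑ᵛ-cong h (λ b → ∑ᵛ-cong h (λ f → split a b f))) ⟩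
    ∑ᵛ h (λ a → ∑ᵛ h (λ b → ∑ᵛ h (λ f → ∑[ x < g ]
      (𝟙[ extends? A S a f x ] * (𝟙[ onSeparator? S f x ] * 𝟙[ extends? B S b f x ])))))
      ≡⟨ ∑ᵛ-factor h (λ a f x → 𝟙[ extends? A S a f x ]) (λ b f x → 𝟙[ extends? B S b f x ])
                     (λ f x → 𝟙[ onSeparator? S f x ]) ⟩
    ∑ᵛ h (λ f → ∑[ x < g ] (extensions A S f x * (𝟙[ onSeparator? S f x ] * extensions B S f x))) ∎
    where
    open ≡-Reasoning
    Ψ : Vec (Fin g) h → ℕ
    Ψ w = 𝟙[ isHom? H G (lookup w) ×-dec collapses? (lookup S) (lookup w) ]
    split : ∀ a b f → Ψ (splice A a (splice B b f)) ≡
            ∑[ x < g ] (𝟙[ extends? A S a f x ] * (𝟙[ onSeparator? S f x ] * 𝟙[ extends? B S b f x ]))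
    split a b f = trans (𝟙-collapses-∑ (isHom? H G w) (lookup S) w Ss) (sum-cong-≗ λ x →
      trans (𝟙-cong (glue⇔ S x) (isHom? H G w ×-dec mapsTo? (lookup S) w x)
                    (extends? A S a f x ×-dec onSeparator? S f x ×-dec extends? B S b f x))
            (trans (𝟙-∧ (does (extends? A S a f x)) _)
                   (cong (𝟙[ extends? A S a f x ] *_) (𝟙-∧ (does (onSeparator? S f x)) _))))
      where open Glue a b f

-- Nice triples

module _ {h} {H : Graph h} {A B : Subset h} {φ : Automorphism H} (nice : Nice H A B φ) where
  open Nice nice

  to-involutive : ∀ v → to φ (to φ v) ≡ v
  to-involutive v = trans (cong (to φ) (involution v)) (to-from φ v)

  Nice-swap : Nice H B A φ
  Nice-swap = record
    { involution = involution
    ; cover      = λ v → [ inj₂ ∘ inj₁ , [ inj₁ , inj₂ ∘ inj₂ ]′ ]′ (cover v)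
    ; disjAB     = λ v v∈B v∈A → disjAB v v∈A v∈B
    ; disjAF     = disjBF
    ; disjBF     = disjAF
    ; separates  = λ u v u∈B v∈A uv → separates v u v∈A u∈B (trans (Graph.sym H v u) uv)
    ; imageA⊆B   = B→A
    ; B⊆imageA   = λ a a∈A → to φ a , imageA⊆B a a∈A , to-involutive a
    }
    where
    B→A : ∀ b → b ∈ B → to φ b ∈ A
    B→A b b∈B with B⊆imageA b b∈B
    ... | a , a∈A , φa≡b = subst (_∈ A) (trans (sym (to-involutive a)) (cong (to φ) φa≡b)) a∈A

  nice⇒separation : Separation H A B (isFixed φ)
  nice⇒separation = record
    { cover           = λ v → Sum.map ∈⇒T (Sum.map ∈⇒T fromWitness) (cover v)
    ; B⇒∉A            = λ Bv → dec-false (T? _) (λ Av → disjAB _ (T⇒∈ Av) (T⇒∈ Bv))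
    ; F⇒∉A            = λ Fv → dec-false (T? _) (λ Av → disjAF _ (T⇒∈ Av) (toWitness Fv))
    ; F⇒∉B            = λ Fv → dec-false (T? _) (λ Bv → disjBF _ (T⇒∈ Bv) (toWitness Fv))
    ; A-B-nonadjacent = λ Au Bv uv → separates _ _ (T⇒∈ Au) (T⇒∈ Bv) (⇔.to T-≡ uv)
    }

∪ᵇ-∈ : ∀ {h} {H : Graph h} {φ : Automorphism H} (X : Subset h) {v} →
       v ∈ X ⊎ Fixed φ v → T ((X ∪ᵇ isFixed φ) v)
∪ᵇ-∈ {φ = φ} X = [ ∪ᵇ-inj₁ X (isFixed φ) ∘ ∈⇒T , ∪ᵇ-inj₂ X (isFixed φ) ∘ fromWitness ]′

module _ {h} {H : Graph h} (A B : Subset h) (φ : Automorphism H) (R : Subset h) where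

  private
    lookup-ψ : ∀ v → lookup (ψ A B φ R) v ≡ (R ∩ᵇ (A ∪ᵇ isFixed φ)) v ∨ (R ∩ᵇ lookup A) (from φ v)
    lookup-ψ = lookup∘tabulate _

  ψ-intro₁ : ∀ {v} → T (lookup R v) → T ((A ∪ᵇ isFixed φ) v) → T (lookup (ψ A B φ R) v)
  ψ-intro₁ {v} Rv A∪Fv = subst T (sym (lookup-ψ v)) (⇔.from T-∨ (inj₁ (∧-intro Rv A∪Fv)))

  ψ-intro₂ : ∀ {u} → T (lookup R u) → T (lookup A u) → T (lookup (ψ A B φ R) (to φ u))
  ψ-intro₂ {u} Ru Au = subst T (sym (lookup-ψ (to φ u))) (⇔.from T-∨ (inj₂
    (subst (T ∘ (R ∩ᵇ lookup A)) (sym (from-to φ u)) (∧-intro Ru Au))))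

  ψ-elim : ∀ {v} → T (lookup (ψ A B φ R) v) →
           (T (lookup R v) × T ((A ∪ᵇ isFixed φ) v)) ⊎ (T (lookup R (from φ v)) × T (lookup A (from φ v)))
  ψ-elim {v} = Sum.map ∧-elim ∧-elim ∘ ⇔.to T-∨ ∘ subst T (lookup-ψ v)

module ψ-Counts {h g} (H : Graph h) (G : Graph g) {A B : Subset h} {φ : Automorphism H}
                (nice : Nice H A B φ) where
  open Nice nice using (imageA⊆B; involution)
  open Separation (nice⇒separation nice)
  open Factorisation H G (nice⇒separation nice)

  private
    F : Fin h → Bool
    F = isFixed φ

    π : Fin h → Fin h
    π = to φ

    π² : ∀ v → π (π v) ≡ v
    π² = to-involutive nice

    π-adj : ∀ u v → T (adj H u v) → T (adj H (π u) (π v))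
    π-adj u v = subst T (preserves φ u v)

    π-fixes-F : ∀ {v} → T (F v) → π v ≡ v
    π-fixes-F = toWitness

    φ⁻¹-fixes-F : ∀ {v} → T (F v) → from φ v ≡ v
    φ⁻¹-fixes-F {v} Fv = trans (sym (involution v)) (π-fixes-F Fv)

    A→B : ∀ {v} → T (lookup A v) → T (lookup B (π v))
    A→B Av = ∈⇒T (imageA⊆B _ (T⇒∈ Av))

    B→A : ∀ {v} → T (lookup B v) → T (lookup A (π v))
    B→A Bv = ∈⇒T (Nice.imageA⊆B (Nice-swap nice) _ (T⇒∈ Bv))

    F→F : ∀ {v} → T (F v) → T (F (π v))
    F→F Fv = subst (T ∘ F) (sym (π-fixes-F Fv)) Fv

    A∪F→B∪F : ∀ v → T ((A ∪ᵇ F) v) → T ((B ∪ᵇ F) (π v))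
    A∪F→B∪F v = [ ∪ᵇ-inj₁ B F ∘ A→B , ∪ᵇ-inj₂ B F ∘ F→F ]′ ∘ ⇔.to T-∨

    B∪F→A∪F : ∀ v → T ((B ∪ᵇ F) v) → T ((A ∪ᵇ F) (π v))
    B∪F→A∪F v = [ ∪ᵇ-inj₁ A F ∘ B→A , ∪ᵇ-inj₂ A F ∘ F→F ]′ ∘ ⇔.to T-∨

    absurd : ∀ {b} → T b → b ≡ false → ∀ {ℓ} {X : Set ℓ} → X
    absurd t b≡false = ⊥-elim (subst T b≡false t)

  module _ (R : Subset h) where

    private
      ψR : Subset h
      ψR = ψ A B φ R

      ψ∩A⊆R∩A : ∀ v → T ((ψR ∩ᵇ lookup A) v) → T ((R ∩ᵇ lookup A) v)
      ψ∩A⊆R∩A v t with ∧-elim t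
      ... | ψv , Av with ψ-elim A B φ R ψv
      ...   | inj₁ (Rv , _)   = ∧-intro Rv Av
      ...   | inj₂ (_ , A[φ⁻¹v]) = absurd Av (B⇒∉A (subst (T ∘ lookup B) (to-from φ v) (A→B A[φ⁻¹v])))

      R∩A⊆ψ∩A : ∀ v → T ((R ∩ᵇ lookup A) v) → T ((ψR ∩ᵇ lookup A) v)
      R∩A⊆ψ∩A v t with ∧-elim t
      ... | Rv , Av = ∧-intro (ψ-intro₁ A B φ R Rv (∪ᵇ-inj₁ A F Av)) Av

      ψ∩F⊆R∩F : ∀ v → T ((ψR ∩ᵇ F) v) → T ((R ∩ᵇ F) v)
      ψ∩F⊆R∩F v t with ∧-elim t
      ... | ψv , Fv with ψ-elim A B φ R ψv
      ...   | inj₁ (Rv , _)      = ∧-intro Rv Fv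
      ...   | inj₂ (R[φ⁻¹v] , _) = ∧-intro (subst (T ∘ lookup R) (φ⁻¹-fixes-F Fv) R[φ⁻¹v]) Fv

      R∩F⊆ψ∩F : ∀ v → T ((R ∩ᵇ F) v) → T ((ψR ∩ᵇ F) v)
      R∩F⊆ψ∩F v t with ∧-elim t
      ... | Rv , Fv = ∧-intro (ψ-intro₁ A B φ R Rv (∪ᵇ-inj₂ A F Fv)) Fv

      ψ∩B→R∩A : ∀ v → T ((ψR ∩ᵇ lookup B) v) → T ((R ∩ᵇ lookup A) (π v))
      ψ∩B→R∩A v t with ∧-elim t
      ... | ψv , Bv with ψ-elim A B φ R ψv
      ...   | inj₁ (_ , A∪Fv) =
        [ (λ Av → absurd Av (B⇒∉A Bv)) , (λ Fv → absurd Bv (F⇒∉B Fv)) ]′ (⇔.to T-∨ A∪Fv)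
      ...   | inj₂ (R[φ⁻¹v] , A[φ⁻¹v]) =
        subst (T ∘ (R ∩ᵇ lookup A)) (sym (involution v)) (∧-intro R[φ⁻¹v] A[φ⁻¹v])

      R∩A→ψ∩B : ∀ v → T ((R ∩ᵇ lookup A) v) → T ((ψR ∩ᵇ lookup B) (π v))
      R∩A→ψ∩B v t with ∧-elim t
      ... | Rv , Av = ∧-intro (ψ-intro₂ A B φ R Rv Av) (A→B Av)

    extensions-ψ-A : ∀ f x → extensions A ψR f x ≡ extensions A R f x
    extensions-ψ-A f x = ∑ᵛ-cong h λ a → 𝟙-cong
      (mk⇔ (Product.map₂ (MapsTo-⊆ R∩A⊆ψ∩A)) (Product.map₂ (MapsTo-⊆ ψ∩A⊆R∩A)))
      (extends? A ψR a f x) (extends? A R a f x)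

    onSeparator-ψ : ∀ f x → 𝟙[ onSeparator? ψR f x ] ≡ 𝟙[ onSeparator? R f x ]
    onSeparator-ψ f x = 𝟙-cong (mk⇔ (MapsTo-⊆ R∩F⊆ψ∩F) (MapsTo-⊆ ψ∩F⊆R∩F))
                               (onSeparator? ψR f x) (onSeparator? R f x)

    extensions-ψ-B : ∀ f x → extensions B ψR f x ≡ extensions A R f x
    extensions-ψ-B f x = begin
      ∑ᵛ h (λ b → 𝟙[ extends? B ψR b f x ])
        ≡⟨ ∑ᵛ-permute h π π π² π² _ ⟨
      ∑ᵛ h (λ a → 𝟙[ extends? B ψR (permute π a) f x ])
        ≡⟨ ∑ᵛ-cong h (λ a → 𝟙-cong (mirror a) (extends? B ψR (permute π a) f x) (extends? A R a f x)) ⟩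
      ∑ᵛ h (λ a → 𝟙[ extends? A R a f x ]) ∎
      where
      open ≡-Reasoning
      -- Substitute b = a ∘ φ: φ maps B ∪ F onto A ∪ F and ψR ∩ B onto R ∩ A.
      mirror : ∀ a → Extends B ψR (permute π a) f x ⇔ Extends A R a f x
      mirror a = mk⇔
        (λ (hom , m) →
            HomOn-⊆ H G A∪F→B∪F (HomOn-agree H G (λ v _ → cong s (π² v))
              (HomOn-∘ H G π π-adj (HomOn-agree H G s′≈s∘π hom)))
          , MapsTo-⊆ R∩A→ψ∩B (MapsTo-agree (λ v _ → cong (lookup a) (π² v))
              (MapsTo-∘ π (MapsTo-agree (λ v _ → lookup∘tabulate _ v) m))))
        (λ (hom , m) →
            HomOn-agree H G (agree-sym s′≈s∘π) (HomOn-⊆ H G B∪F→A∪F (HomOn-∘ H G π π-adj hom))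
          , MapsTo-agree (λ v _ → sym (lookup∘tabulate _ v)) (MapsTo-⊆ ψ∩B→R∩A (MapsTo-∘ π m)))
        where
        s s′ : Fin h → Fin g
        s  = lookup (splice A a f)
        s′ = lookup (splice B (permute π a) f)
        s′≈s∘π : Agree (B ∪ᵇ F) s′ (s ∘ π)
        s′≈s∘π v = [ (λ Bv → trans (splice-in B _ f Bv)
                                   (trans (lookup∘tabulate _ v) (sym (splice-in A a f (B→A Bv)))))
                   , (λ Fv → trans (splice-out B _ f (F⇒∉B Fv))
                                   (sym (trans (cong s (π-fixes-F Fv)) (splice-out A a f (F⇒∉A Fv))))) ]′
                   ∘ ⇔.to T-∨

idem-regroup : ∀ m a b → m * m ≡ m → a * (m * b) ≡ (m * a) * (m * b)
idem-regroup m a b m²≡m = begin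
  a * (m * b)        ≡⟨ pull m a b ⟩
  m * (a * b)        ≡⟨ cong (_* (a * b)) m²≡m ⟨
  (m * m) * (a * b)  ≡⟨ spread m a b ⟩
  (m * a) * (m * b)  ∎
  where
  open ≡-Reasoning
  pull : ∀ m a b → a * (m * b) ≡ m * (a * b)
  pull = solve-∀
  spread : ∀ m a b → (m * m) * (a * b) ≡ (m * a) * (m * b)
  spread = solve-∀

cancel-squares : ∀ k {a b c} .{{_ : NonZero k}} → (k * a) * (k * a) ≤ (k * b) * (k * c) → a * a ≤ b * c
cancel-squares k {a} {b} {c} le = *-cancelˡ-≤ (k * k) {{m*n≢0 k k}}
  (subst₂ _≤_ (squares k a a) (squares k b c) le)
  where
  squares : ∀ k a b → (k * a) * (k * b) ≡ (k * k) * (a * b)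
  squares = solve-∀

homR²≤homRψ*homRψ : ∀ {h g} (H : Graph h) (G : Graph g) {A B φ} → Nice H A B φ → ∀ R {s t} →
  T (lookup R s) → T (lookup (ψ A B φ R) s) → T (lookup (ψ B A φ R) t) →
  homR H G R * homR H G R ≤ homR H G (ψ A B φ R) * homR H G (ψ B A φ R)
homR²≤homRψ*homRψ {g = zero} H G {A} {B} {φ} nice R {s} _ _ _ =
  subst (λ n → n * n ≤ homR H G (ψ A B φ R) * homR H G (ψ B A φ R)) (sym (homR-empty H G R s)) z≤n
homR²≤homRψ*homRψ {h} {g@(suc _)} H G {A} {B} {φ} nice R Rs ψs ψt =
  cancel-squares (g ^ h * g ^ h) (begin
    (K * homR H G R) * (K * homR H G R)
      ≡⟨ cong₂ _*_ factor-R factor-R ⟩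
    ∑ᵛ (suc h) (λ i → u i * v i) * ∑ᵛ (suc h) (λ i → u i * v i)
      ≤⟨ cauchy-schwarz (suc h) u v ⟩
    ∑ᵛ (suc h) (λ i → u i * u i) * ∑ᵛ (suc h) (λ i → v i * v i)
      ≡⟨ cong₂ _*_ factor-ψAB factor-ψBA ⟨
    (K * homR H G (ψ A B φ R)) * (K * homR H G (ψ B A φ R)) ∎)
  where
  instance
    _ = m*n≢0 (g ^ h) (g ^ h) {{m^n≢0 g h}} {{m^n≢0 g h}}
  open ≤-Reasoning
  open Factorisation H G (nice⇒separation nice)
  module AB = ψ-Counts H G nice
  module BA = ψ-Counts H G (Nice-swap nice)
  module Sw = Factorisation H G (nice⇒separation (Nice-swap nice))
  K = g ^ h * g ^ h
  m α β : Vec (Fin g) h → Fin g → ℕ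
  m f x = 𝟙[ onSeparator? R f x ]
  α = extensions A R
  β = extensions B R
  u v : Vec (Fin g) (suc h) → ℕ
  u (x ∷ f) = m f x * α f x
  v (x ∷ f) = m f x * β f x
  m²≡m : ∀ f x → m f x * m f x ≡ m f x
  m²≡m f x = 𝟙-idem _
  factor-R : K * homR H G R ≡ ∑ᵛ (suc h) (λ i → u i * v i)
  factor-R = trans (factorisation R Rs) (∑ᵛ-cong h λ f → sum-cong-≗ λ x →
    idem-regroup (m f x) (α f x) (β f x) (m²≡m f x))
  factor-ψAB : K * homR H G (ψ A B φ R) ≡ ∑ᵛ (suc h) (λ i → u i * u i)
  factor-ψAB = trans (factorisation (ψ A B φ R) ψs) (∑ᵛ-cong h λ f → sum-cong-≗ λ x →
    trans (cong₂ _*_ (AB.extensions-ψ-A R f x) (cong₂ _*_ (AB.onSeparator-ψ R f x) (AB.extensions-ψ-B R f x)))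
          (idem-regroup (m f x) (α f x) (α f x) (m²≡m f x)))
  factor-ψBA : K * homR H G (ψ B A φ R) ≡ ∑ᵛ (suc h) (λ i → v i * v i)
  factor-ψBA = trans (Sw.factorisation (ψ B A φ R) ψt) (∑ᵛ-cong h λ f → sum-cong-≗ λ x →
    trans (cong₂ _*_ (BA.extensions-ψ-A R f x) (cong₂ _*_ (BA.onSeparator-ψ R f x) (BA.extensions-ψ-B R f x)))
          (idem-regroup (m f x) (β f x) (β f x) (m²≡m f x)))

lemma2p11 : ∀ {h} (H : Graph h) (c : Fin h → Bool) → ProperTwoColouring H c → Connected H →
    (A B : Subset h) (φ : Automorphism H) → Nice H A B φ →
    (R : Subset h) → Admissible H c A B φ R →
    ∀ {g} (G : Graph g) →
      (homR H G R * homR H G R ≤ homR H G (ψ A B φ R) * homR H G (ψ B A φ R))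
      × (homR H G R * homR H G R ≤ homR H G (ψ A B φ R) * hom H G)
lemma2p11 H _ _ _ A B φ nice R adm G with Admissible.meetsAF adm | Admissible.meetsBF adm
... | _ , s∈R , s∈A∪F | _ , t∈R , t∈B∪F =
  main , ≤-trans main (*-monoʳ-≤ (homR H G (ψ A B φ R)) (homR≤hom H G (ψ B A φ R)))
  where
  main = homR²≤homRψ*homRψ H G nice R (∈⇒T s∈R) (ψ-intro₁ A B φ R (∈⇒T s∈R) (∪ᵇ-∈ {φ = φ} A s∈A∪F))
                                                (ψ-intro₁ B A φ R (∈⇒T t∈R) (∪ᵇ-∈ {φ = φ} B t∈B∪F))
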